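{- Let $k\geq2$ be an integer and $A=\{m^k: m \text{ a positive integer}\}$. Then the sequence $(w^A(n))_{n\ge0}$ is not eventually periodic.
   Context: For a (possibly infinite) nonempty set $A$ of positive integers, $w^A:\mathbb{Z}\to\{0,1\}$ is defined by $w^A(n)=1$ for $n<0$ and $w^A(n)=1-\min\{w^A(n-x):x\in A\}$ for $n\ge0$. A sequence is eventually periodic if there exist $N\ge0$, $p\ge1$ with $w^A(n)=w^A(n+p)$ for all $n\ge N$. -}

module Defs where

open import Data.Nat using (ℕ; zero; suc; _≤_; _<_; _^_)
open import Data.Integer as ℤ using (ℤ; +_)
open import Data.Product using (Σ; ∃; _×_)
open import Data.Sum using (_⊎_)
open import Relation.Binary.PropositionalEquality using (_≡_)
open import Relation.Unary using (Pred; _∈_)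
open import Level using (0ℓ)

KthPowers : ℕ → Pred ℕ 0ℓ
KthPowers k x = ∃ λ m → 1 ≤ m × x ≡ m ^ k

IsMinOver : Pred ℕ 0ℓ → (ℤ → ℕ) → ℤ → ℕ → Set
IsMinOver A w n m =
  (∀ x → x ∈ A → m ≤ w (n ℤ.- + x)) × (∃ λ x → x ∈ A × w (n ℤ.- + x) ≡ m)

IsWA : Pred ℕ 0ℓ → (ℤ → ℕ) → Set
IsWA A w =
  (∀ n → w n ≡ 0 ⊎ w n ≡ 1) ×
  (∀ n → n ℤ.< + 0 → w n ≡ 1) ×
  (∀ (n : ℕ) → ∃ λ m → IsMinOver A w (+ n) m × w (+ n) ≡ 1 Data.Nat.∸ m)

EventuallyPeriodic : (ℕ → ℕ) → Set
EventuallyPeriodic s =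
  ∃ λ N → ∃ λ p → 1 ≤ p × (∀ n → N ≤ n → s n ≡ s (n Data.Nat.+ p))

-- A kth power p ^ k is a move that is a multiple of any candidate period p. If w were
-- eventually p-periodic from N, a zero w(z) = 0 with z ≥ N would give w(z + p ^ k) = w(z) = 0,
-- although z + p ^ k has the move p ^ k to the zero z. So w is eventually 1, and every
-- n ≥ N has a move x landing on a zero below N, i.e. with n − N < x ≤ n. For
-- n = N ^ k + N this fails, since no kth power lies in (N ^ k , N ^ k + N]
-- as (N + 1) ^ k > N ^ k + N.
module Submission where

open import Defs
open import Data.Nat using (ℕ; _≤_)
open import Data.Integer using (ℤ; +_)
open import Relation.Nullary using (¬_)

open import Data.Nat using (zero; suc; _+_; _*_; _∸_; _^_; _<_; s≤s)
open import Data.Nat.Properties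
open import Data.Nat.Divisibility using (_∣_; divides; m∣m*n)
import Data.Integer as ℤ
import Data.Integer.Properties as ℤ
open import Data.Product using (∃; _×_; _,_; proj₁; proj₂)
open import Data.Sum using (inj₁; inj₂)
open import Function using (_∘_)
open import Level using (0ℓ)
open import Relation.Nullary using (contradiction)
open import Relation.Unary using (Pred; _∈_)
open import Relation.Binary.PropositionalEquality

+m-+n≡+[m∸n] : ∀ {m n} → n ≤ m → + m ℤ.- + n ≡ + (m ∸ n)
+m-+n≡+[m∸n] {m} {n} n≤m = trans (ℤ.m-n≡m⊖n m n) (ℤ.⊖-≥ n≤m)

+m-+n<0 : ∀ {m n} → m < n → + m ℤ.- + n ℤ.< + 0
+m-+n<0 {m} {n} m<n =
  subst₂ ℤ._<_ (sym (ℤ.m-n≡m⊖n m n)) (ℤ.n⊖n≡0 m) (ℤ.⊖-monoʳ->-< m m<n)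

1∸m≡1⇒m≡0 : ∀ {m} → 1 ∸ m ≡ 1 → m ≡ 0
1∸m≡1⇒m≡0 {zero}        _  = refl
1∸m≡1⇒m≡0 {suc zero}    ()
1∸m≡1⇒m≡0 {suc (suc _)} ()

m^n+m<[1+m]^n : ∀ m n → 2 ≤ n → m ^ n + m < suc m ^ n
m^n+m<[1+m]^n m (suc zero)    (s≤s ())
m^n+m<[1+m]^n m (suc (suc j)) _ = begin-strict
  m * m ^ suc j + m            <⟨ +-monoʳ-< (m * m ^ suc j) (n<1+n m) ⟩
  m * m ^ suc j + suc m        ≤⟨ +-mono-≤ (*-monoʳ-≤ m (^-monoˡ-≤ (suc j) (n≤1+n m)))
                                           (m≤m*n (suc m) (suc m ^ j) {{m^n≢0 (suc m) j}}) ⟩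
  m * suc m ^ suc j + suc m ^ suc j ≡⟨ +-comm (m * suc m ^ suc j) _ ⟩
  suc m ^ suc (suc j)          ∎
  where open ≤-Reasoning

module _ {s : ℕ → ℕ} {N p : ℕ} (periodic : ∀ n → N ≤ n → s n ≡ s (n + p)) where

  periodic-+* : ∀ q n → N ≤ n → s (n + q * p) ≡ s n
  periodic-+* zero    n _   = cong s (+-identityʳ n)
  periodic-+* (suc q) n N≤n = begin
    s (n + (p + q * p)) ≡⟨ cong s (+-assoc n p (q * p)) ⟨
    s (n + p + q * p)   ≡⟨ periodic-+* q (n + p) (≤-trans N≤n (m≤m+n n p)) ⟩
    s (n + p)           ≡⟨ periodic n N≤n ⟨
    s n                 ∎
    where open ≡-Reasoning

  periodic-∣ : ∀ {d} → p ∣ d → ∀ n → N ≤ n → s (n + d) ≡ s n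
  periodic-∣ (divides q refl) = periodic-+* q

module _ {A : Pred ℕ 0ℓ} {w : ℤ → ℕ} (wA : IsWA A w) where

  private
    binary    = proj₁ wA
    negative  = proj₁ (proj₂ wA)
    recursion = proj₂ (proj₂ wA)

  w≡0⇒w[+move]≡1 : ∀ z {x} → x ∈ A → w (+ z) ≡ 0 → w (+ (z + x)) ≡ 1
  w≡0⇒w[+move]≡1 z {x} x∈A wz≡0 with recursion (z + x)
  ... | m , (m≤ , _) , w≡1∸m = trans w≡1∸m (cong (1 ∸_) m≡0)
    where
    m≡0 : m ≡ 0
    m≡0 = n≤0⇒n≡0 (begin
      m                          ≤⟨ m≤ x x∈A ⟩
      w (+ (z + x) ℤ.- + x)      ≡⟨ cong w (+m-+n≡+[m∸n] (m≤n+m x z)) ⟩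
      w (+ (z + x ∸ x))          ≡⟨ cong (w ∘ +_) (m+n∸n≡m z x) ⟩
      w (+ z)                    ≡⟨ wz≡0 ⟩
      0                          ∎)
      where open ≤-Reasoning

  w≡1⇒move-to-0 : ∀ n → w (+ n) ≡ 1 → ∃ λ x → x ∈ A × x ≤ n × w (+ (n ∸ x)) ≡ 0
  w≡1⇒move-to-0 n wn≡1 with recursion n
  ... | m , (_ , x , x∈A , w[n-x]≡m) , w≡1∸m = x , x∈A , x≤n , w[n∸x]≡0
    where
    w[n-x]≡0 : w (+ n ℤ.- + x) ≡ 0
    w[n-x]≡0 = trans w[n-x]≡m (1∸m≡1⇒m≡0 (trans (sym w≡1∸m) wn≡1))
    x≤n : x ≤ n
    x≤n = ≮⇒≥ λ n<x → contradiction (trans (sym (negative _ (+m-+n<0 n<x))) w[n-x]≡0) λ ()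
    w[n∸x]≡0 : w (+ (n ∸ x)) ≡ 0
    w[n∸x]≡0 = trans (cong w (sym (+m-+n≡+[m∸n] x≤n))) w[n-x]≡0

  periodic⇒eventually-1 : ∀ {N p d} → d ∈ A → p ∣ d →
    (∀ n → N ≤ n → w (+ n) ≡ w (+ (n + p))) → ∀ n → N ≤ n → w (+ n) ≡ 1
  periodic⇒eventually-1 d∈A p∣d periodic n N≤n with binary (+ n)
  ... | inj₂ wn≡1 = wn≡1
  ... | inj₁ wn≡0 = contradiction
          (trans (sym (w≡0⇒w[+move]≡1 n d∈A wn≡0))
                 (trans (periodic-∣ periodic p∣d n N≤n) wn≡0)) λ ()

  eventually-1⇒move-near : ∀ {N} → (∀ n → N ≤ n → w (+ n) ≡ 1) →
    ∀ n → N ≤ n → ∃ λ x → x ∈ A × x ≤ n × n < x + N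
  eventually-1⇒move-near {N} eventually-1 n N≤n with w≡1⇒move-to-0 n (eventually-1 n N≤n)
  ... | x , x∈A , x≤n , w[n∸x]≡0 = x , x∈A , x≤n , (begin-strict
    n           ≡⟨ m+[n∸m]≡n x≤n ⟨
    x + (n ∸ x) <⟨ +-monoʳ-< x n∸x<N ⟩
    x + N       ∎)
    where
    open ≤-Reasoning
    n∸x<N : n ∸ x < N
    n∸x<N = ≰⇒> λ N≤n∸x → contradiction (trans (sym w[n∸x]≡0) (eventually-1 _ N≤n∸x)) λ ()

^∈KthPowers : ∀ k {p} → 1 ≤ p → p ^ k ∈ KthPowers k
^∈KthPowers k 1≤p = _ , 1≤p , refl

KthPowers-gap : ∀ k {N x} → 2 ≤ k → x ∈ KthPowers k → N ^ k < x → N ^ k + N < x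
KthPowers-gap k {N} 2≤k (q , _ , refl) N^k<q^k = begin-strict
  N ^ k + N <⟨ m^n+m<[1+m]^n N k 2≤k ⟩
  suc N ^ k ≤⟨ ^-monoˡ-≤ k N<q ⟩
  q ^ k     ∎
  where
  open ≤-Reasoning
  N<q : N < q
  N<q = ≰⇒> λ q≤N → <⇒≱ N^k<q^k (^-monoˡ-≤ k q≤N)

proposition2p5 : (k : ℕ) → 2 ≤ k → (w : ℤ → ℕ) → IsWA (KthPowers k) w →
    ¬ EventuallyPeriodic (λ n → w (+ n))
proposition2p5 k@(suc k′) 2≤k w wA (N , p , 1≤p , periodic)
  with eventually-1⇒move-near wA eventually-1 (N ^ k + N) (m≤n+m N (N ^ k))
  where
  eventually-1 : ∀ n → N ≤ n → w (+ n) ≡ 1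
  eventually-1 = periodic⇒eventually-1 wA (^∈KthPowers k 1≤p) (m∣m*n (p ^ k′)) periodic
... | x , x∈A , x≤N^k+N , N^k+N<x+N =
  <⇒≱ (KthPowers-gap k {N} 2≤k x∈A (+-cancelʳ-< N (N ^ k) x N^k+N<x+N)) x≤N^k+N
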